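{- Let $k$, $p$, $c$ be integers with $k \geq 0$, $p \geq 1$, $c \geq 3$. Let $G=(V,E)$ be a $k$-FT($pK_c$) graph with $|V|=pc+k$. Then every vertex $x\in V$ with $d(x) = c+k-1$ belongs to a subgraph of $G$ isomorphic to $K_{c+k}$. Moreover, if $W\subset V$ is a separator of size $k$ in $G$ and $A$ is a connected component of $G-W$ with $|V(A)|=c$, then $W \cup V(A)$ is a clique in $G$.
   Context: All graphs are finite, simple and undirected. For integers $k\ge 0$, $p\ge 1$, $c\ge 2$, a graph $G=(V,E)$ is called $k$-FT($pK_c$) if for every $S\subset V$ with $|S|\le k$, the graph $G-S$ contains as a subgraph the disjoint union of $p$ complete graphs $K_c$. A separator of $G$ is a set $W\subset V$ such that $G-W$ is disconnected. A clique is a set of pairwise adjacent vertices. -}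

module Defs where

open import Data.Nat using (ℕ; _≤_)
open import Data.Bool using (Bool; true; false)
open import Data.Fin using (Fin)
open import Data.Fin.Subset using (Subset; _∈_; _∉_; ∣_∣)
open import Data.Vec using (tabulate)
open import Data.Product using (Σ; ∃; _×_)
open import Relation.Binary.PropositionalEquality using (_≡_; _≢_)
open import Relation.Nullary using (¬_)

record Graph (n : ℕ) : Set where
  field
    adj     : Fin n → Fin n → Bool
    sym     : ∀ u v → adj u v ≡ adj v u
    irrefl  : ∀ u → adj u u ≡ false
open Graph public

module _ {n : ℕ} (G : Graph n) where

  degree : Fin n → ℕ
  degree x = ∣ tabulate (adj G x) ∣

  IsClique : Subset n → Set
  IsClique S = ∀ u v → u ∈ S → v ∈ S → u ≢ v → adj G u v ≡ true

  ContainsPKcAvoiding : (p c : ℕ) → Subset n → Set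
  ContainsPKcAvoiding p c S =
    Σ (Fin p → Subset n) λ C →
      (∀ i → ∣ C i ∣ ≡ c) ×
      (∀ i → IsClique (C i)) ×
      (∀ i v → v ∈ C i → v ∉ S) ×
      (∀ i j v → v ∈ C i → v ∈ C j → i ≡ j)

  FT : (k p c : ℕ) → Set
  FT k p c = ∀ (S : Subset n) → ∣ S ∣ ≤ k → ContainsPKcAvoiding p c S

  data Reach (W : Subset n) : Fin n → Fin n → Set where
    here : ∀ {u} → u ∉ W → Reach W u u
    step : ∀ {u v w} → Reach W u v → adj G v w ≡ true → w ∉ W → Reach W u w

  IsSeparator : Subset n → Set
  IsSeparator W = Σ (Fin n) λ u → Σ (Fin n) λ v →
    u ∉ W × v ∉ W × ¬ Reach W u v

  IsComponent : Subset n → Subset n → Set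
  IsComponent W A =
    (∃ λ u → u ∈ A) ×
    (∀ u → u ∈ A → u ∉ W) ×
    (∀ u v → u ∈ A → (v ∈ A → Reach W u v) × (Reach W u v → v ∈ A))

-- Call a set Q of c + k vertices absorbing at w ∈ Q if every clique through w lies
-- in Q.  Such a Q is a clique: for a ≠ b in Q, delete a set S of k vertices of Q
-- other than a, b, w.  The p disjoint copies of K_c in G − S have pc vertices in
-- total, which is all of G − S, so one of them, C, contains w.  Then C ⊆ Q − S, and
-- both have c vertices, so a, b ∈ C are adjacent.  The closed neighbourhood of a
-- vertex of degree c + k − 1 is absorbing at that vertex, and so is W ∪ A at any
-- vertex of the component A, because a clique cannot leave A except into W.
module Submission where

open import Defs hiding (sym)
open import Data.Nat using (ℕ; zero; suc; _+_; _*_; _≤_; z≤n; s≤s)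
open import Data.Nat.Properties
  using (+-suc; +-comm; n≤1+n; ≤-trans; ≤-reflexive; <-irrefl; +-monoʳ-≤; +-cancelʳ-≤; module ≤-Reasoning)
open import Data.Fin using (Fin; zero; suc; _≟_)
open import Data.Fin.Properties using (suc-injective)
open import Data.Fin.Subset using (Subset; _∈_; _∉_; _∪_; _─_; ∣_∣; _⊆_; ⁅_⁆; ⊥; ⊤; inside; outside)
open import Data.Fin.Subset.Properties
  using (_∈?_; x∈p∪q⁺; x∈p∪q⁻; p⊆p∪q; q⊆p∪q; p─q⊆p; x∈p∧x∉q⇒x∈p─q; p⊆q⇒∣p∣≤∣q∣; p⊂q⇒∣p∣<∣q∣;
         out⊆; in⊆in; ⊥⊆; ∣⊥∣≡0; ∉⊥; ∣p∣≡n⇒p≡⊤; ∈⊤; x∈⁅x⁆; x∈⁅y⁆⇒x≡y; ∣⁅x⁆∣≡1)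
open import Data.Vec using ([]; _∷_; here; there; tabulate)
open import Data.Vec.Properties using (lookup⇒[]=; []=⇒lookup; lookup∘tabulate)
open import Data.Product using (Σ; ∃; _×_; _,_; proj₂)
open import Data.Sum using (inj₁; inj₂)
open import Data.Bool using (true)
open import Data.Empty using (⊥-elim)
open import Function using (_∘_)
open import Relation.Nullary using (yes; no)
open import Relation.Binary.PropositionalEquality using (_≡_; refl; sym; trans; cong; cong₂; subst; _≢_)

private
  variable
    n : ℕ

Disjoint : Subset n → Subset n → Set
Disjoint p q = ∀ {x} → x ∈ p → x ∉ q

∣p∪q∣≡∣p∣+∣q∣ : (p q : Subset n) → Disjoint p q → ∣ p ∪ q ∣ ≡ ∣ p ∣ + ∣ q ∣
∣p∪q∣≡∣p∣+∣q∣ []            []            _ = refl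
∣p∪q∣≡∣p∣+∣q∣ (inside  ∷ p) (inside  ∷ q) d = ⊥-elim (d here here)
∣p∪q∣≡∣p∣+∣q∣ (inside  ∷ p) (outside ∷ q) d = cong suc (∣p∪q∣≡∣p∣+∣q∣ p q (λ x∈p x∈q → d (there x∈p) (there x∈q)))
∣p∪q∣≡∣p∣+∣q∣ (outside ∷ p) (inside  ∷ q) d =
  trans (cong suc (∣p∪q∣≡∣p∣+∣q∣ p q (λ x∈p x∈q → d (there x∈p) (there x∈q)))) (sym (+-suc ∣ p ∣ ∣ q ∣))
∣p∪q∣≡∣p∣+∣q∣ (outside ∷ p) (outside ∷ q) d = ∣p∪q∣≡∣p∣+∣q∣ p q (λ x∈p x∈q → d (there x∈p) (there x∈q))

∣p∪q∣≤∣p∣+∣q∣ : (p q : Subset n) → ∣ p ∪ q ∣ ≤ ∣ p ∣ + ∣ q ∣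
∣p∪q∣≤∣p∣+∣q∣ []            []            = z≤n
∣p∪q∣≤∣p∣+∣q∣ (inside  ∷ p) (inside  ∷ q) = s≤s (≤-trans (∣p∪q∣≤∣p∣+∣q∣ p q) (+-monoʳ-≤ ∣ p ∣ (n≤1+n ∣ q ∣)))
∣p∪q∣≤∣p∣+∣q∣ (inside  ∷ p) (outside ∷ q) = s≤s (∣p∪q∣≤∣p∣+∣q∣ p q)
∣p∪q∣≤∣p∣+∣q∣ (outside ∷ p) (inside  ∷ q) = ≤-trans (s≤s (∣p∪q∣≤∣p∣+∣q∣ p q)) (≤-reflexive (sym (+-suc ∣ p ∣ ∣ q ∣)))
∣p∪q∣≤∣p∣+∣q∣ (outside ∷ p) (outside ∷ q) = ∣p∪q∣≤∣p∣+∣q∣ p q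

∣p∣≤∣p─q∣+∣q∣ : (p q : Subset n) → ∣ p ∣ ≤ ∣ p ─ q ∣ + ∣ q ∣
∣p∣≤∣p─q∣+∣q∣ p q = ≤-trans (p⊆q⇒∣p∣≤∣q∣ p⊆[p─q]∪q) (∣p∪q∣≤∣p∣+∣q∣ (p ─ q) q)
  where
  p⊆[p─q]∪q : p ⊆ (p ─ q) ∪ q
  p⊆[p─q]∪q {x} x∈p with x ∈? q
  ... | yes x∈q = q⊆p∪q (p ─ q) q x∈q
  ... | no  x∉q = p⊆p∪q q (x∈p∧x∉q⇒x∈p─q x∈p x∉q)

x∈p─q⇒x∉q : (p q : Subset n) {x : Fin n} → x ∈ p ─ q → x ∉ q
x∈p─q⇒x∉q (_ ∷ p) (outside ∷ q) {zero}  _           ()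
x∈p─q⇒x∉q (_ ∷ p) (inside  ∷ q) {zero}  ()          _
x∈p─q⇒x∉q (_ ∷ p) (_       ∷ q) {suc x} (there x∈) (there x∈q) = x∈p─q⇒x∉q p q x∈ x∈q

p⊆q∧∣q∣≤∣p∣⇒q⊆p : {p q : Subset n} → p ⊆ q → ∣ q ∣ ≤ ∣ p ∣ → q ⊆ p
p⊆q∧∣q∣≤∣p∣⇒q⊆p {p = p} p⊆q ∣q∣≤∣p∣ {x} x∈q with x ∈? p
... | yes x∈p = x∈p
... | no  x∉p = ⊥-elim (<-irrefl refl (≤-trans (p⊂q⇒∣p∣<∣q∣ (p⊆q , x , x∈q , x∉p)) ∣q∣≤∣p∣))

⊆-ofSize : (p : Subset n) (m : ℕ) → m ≤ ∣ p ∣ → ∃ λ q → q ⊆ p × ∣ q ∣ ≡ m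
⊆-ofSize         []            zero    z≤n = [] , (λ x∈ → x∈) , refl
⊆-ofSize         (outside ∷ p) m       m≤  with ⊆-ofSize p m m≤
... | q , q⊆p , ∣q∣≡m = outside ∷ q , out⊆ q⊆p , ∣q∣≡m
⊆-ofSize {suc n} (inside  ∷ p) zero    _   = ⊥ , ⊥⊆ , ∣⊥∣≡0 (suc n)
⊆-ofSize         (inside  ∷ p) (suc m) (s≤s m≤) with ⊆-ofSize p m m≤
... | q , q⊆p , ∣q∣≡m = inside ∷ q , in⊆in q⊆p , cong suc ∣q∣≡m

⊆-ofSize-avoiding : (p r : Subset n) (m : ℕ) → m + ∣ r ∣ ≤ ∣ p ∣ → ∃ λ q → q ⊆ p ─ r × ∣ q ∣ ≡ m
⊆-ofSize-avoiding p r m m+∣r∣≤∣p∣ =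
  ⊆-ofSize (p ─ r) m (+-cancelʳ-≤ ∣ r ∣ m (∣ p ─ r ∣) (≤-trans m+∣r∣≤∣p∣ (∣p∣≤∣p─q∣+∣q∣ p r)))

⋃ᶠ : {p : ℕ} → (Fin p → Subset n) → Subset n
⋃ᶠ {p = zero}  C = ⊥
⋃ᶠ {p = suc p} C = C zero ∪ ⋃ᶠ (C ∘ suc)

x∈⋃ᶠ⁻ : {p : ℕ} (C : Fin p → Subset n) {x : Fin n} → x ∈ ⋃ᶠ C → ∃ λ i → x ∈ C i
x∈⋃ᶠ⁻ {p = zero}  C x∈ = ⊥-elim (∉⊥ x∈)
x∈⋃ᶠ⁻ {p = suc p} C x∈ with x∈p∪q⁻ (C zero) (⋃ᶠ (C ∘ suc)) x∈
... | inj₁ x∈C₀ = zero , x∈C₀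
... | inj₂ x∈⋃ with x∈⋃ᶠ⁻ (C ∘ suc) x∈⋃
...   | i , x∈Cᵢ = suc i , x∈Cᵢ

PairwiseDisjoint : {p : ℕ} → (Fin p → Subset n) → Set
PairwiseDisjoint C = ∀ i j v → v ∈ C i → v ∈ C j → i ≡ j

∣⋃ᶠ∣≡p*c : {p : ℕ} (c : ℕ) (C : Fin p → Subset n) → (∀ i → ∣ C i ∣ ≡ c) → PairwiseDisjoint C →
  ∣ ⋃ᶠ C ∣ ≡ p * c
∣⋃ᶠ∣≡p*c {n} {p = zero}  c C _     _    = ∣⊥∣≡0 n
∣⋃ᶠ∣≡p*c {p = suc p} c C ∣C∣≡c disj =
  trans (∣p∪q∣≡∣p∣+∣q∣ (C zero) (⋃ᶠ (C ∘ suc)) C₀-disjoint)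
        (cong₂ _+_ (∣C∣≡c zero)
                   (∣⋃ᶠ∣≡p*c c (C ∘ suc) (∣C∣≡c ∘ suc) (λ i j v x∈ y∈ → suc-injective (disj (suc i) (suc j) v x∈ y∈))))
  where
  C₀-disjoint : Disjoint (C zero) (⋃ᶠ (C ∘ suc))
  C₀-disjoint {x} x∈C₀ x∈⋃ with x∈⋃ᶠ⁻ (C ∘ suc) x∈⋃
  ... | i , x∈Cᵢ with disj zero (suc i) x x∈C₀ x∈Cᵢ
  ...   | ()

⋃ᶠ-covers : {p : ℕ} (c : ℕ) (S : Subset n) (C : Fin p → Subset n) → (∀ i → ∣ C i ∣ ≡ c) →
  PairwiseDisjoint C → (∀ i → Disjoint (C i) S) → p * c + ∣ S ∣ ≡ n →
  ∀ {v} → v ∉ S → ∃ λ i → v ∈ C i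
⋃ᶠ-covers c S C ∣C∣≡c disj C-avoids-S size {v} v∉S
  with x∈p∪q⁻ (⋃ᶠ C) S (subst (v ∈_) (sym ⋃ᶠC∪S≡⊤) ∈⊤)
  where
  ⋃ᶠC-avoids-S : Disjoint (⋃ᶠ C) S
  ⋃ᶠC-avoids-S x∈⋃ with x∈⋃ᶠ⁻ C x∈⋃
  ... | i , x∈Cᵢ = C-avoids-S i x∈Cᵢ
  ⋃ᶠC∪S≡⊤ : ⋃ᶠ C ∪ S ≡ ⊤
  ⋃ᶠC∪S≡⊤ = ∣p∣≡n⇒p≡⊤ (trans (∣p∪q∣≡∣p∣+∣q∣ (⋃ᶠ C) S ⋃ᶠC-avoids-S)
                             (trans (cong (_+ ∣ S ∣) (∣⋃ᶠ∣≡p*c c C ∣C∣≡c disj)) size))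
... | inj₁ v∈⋃ = x∈⋃ᶠ⁻ C v∈⋃
... | inj₂ v∈S = ⊥-elim (v∉S v∈S)

module _ (G : Graph n) where

  AbsorbsCliquesThrough : Subset n → Fin n → Set
  AbsorbsCliquesThrough Q w = ∀ C → IsClique G C → w ∈ C → C ⊆ Q

  neighbours : Fin n → Subset n
  neighbours x = tabulate (adj G x)

  ∈-neighbours⁺ : {x y : Fin n} → adj G x y ≡ true → y ∈ neighbours x
  ∈-neighbours⁺ {x} {y} xy = lookup⇒[]= y _ (trans (lookup∘tabulate (adj G x) y) xy)

  ∈-neighbours⁻ : {x y : Fin n} → y ∈ neighbours x → adj G x y ≡ true
  ∈-neighbours⁻ {x} {y} y∈ = trans (sym (lookup∘tabulate (adj G x) y)) ([]=⇒lookup y∈)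

  closedNbhd : Fin n → Subset n
  closedNbhd x = ⁅ x ⁆ ∪ neighbours x

  x∈closedNbhd : (x : Fin n) → x ∈ closedNbhd x
  x∈closedNbhd x = p⊆p∪q _ (x∈⁅x⁆ x)

  ∣closedNbhd∣≡1+degree : (x : Fin n) → ∣ closedNbhd x ∣ ≡ suc (degree G x)
  ∣closedNbhd∣≡1+degree x =
    trans (∣p∪q∣≡∣p∣+∣q∣ ⁅ x ⁆ (neighbours x) x∉neighbours) (cong (_+ degree G x) (∣⁅x⁆∣≡1 x))
    where
    x∉neighbours : Disjoint ⁅ x ⁆ (neighbours x)
    x∉neighbours y∈⁅x⁆ y∈neighbours with x∈⁅y⁆⇒x≡y x y∈⁅x⁆
    ... | refl with trans (sym (∈-neighbours⁻ y∈neighbours)) (irrefl G x)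
    ...   | ()

  closedNbhd-absorbs : (x : Fin n) → AbsorbsCliquesThrough (closedNbhd x) x
  closedNbhd-absorbs x C C-clique x∈C {v} v∈C with v ≟ x
  ... | yes refl = x∈closedNbhd x
  ... | no  v≢x  = q⊆p∪q ⁅ x ⁆ _ (∈-neighbours⁺ (C-clique x v x∈C v∈C (v≢x ∘ sym)))

  component-absorbs : {W A : Subset n} {w : Fin n} → IsComponent G W A → w ∈ A →
    AbsorbsCliquesThrough (W ∪ A) w
  component-absorbs {W} {A} {w} (_ , A-avoids-W , A-closed) w∈A C C-clique w∈C {v} v∈C with v ≟ w | v ∈? W
  ... | yes refl | _        = q⊆p∪q W A w∈A
  ... | no  _    | yes v∈W  = p⊆p∪q A v∈W
  ... | no  v≢w  | no  v∉W  = q⊆p∪q W A (proj₂ (A-closed w v w∈A)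
        (step (here (A-avoids-W w w∈A)) (C-clique w v w∈C v∈C (v≢w ∘ sym)) v∉W))

module _ {k p c : ℕ} (G : Graph (p * c + k)) (ft : FT G k p c) where

  private
    N = p * c + k

  absorbing⇒isClique-minus : {Q S : Subset N} {w : Fin N} → ∣ Q ∣ ≡ c + k → ∣ S ∣ ≡ k → S ⊆ Q →
    w ∈ Q → w ∉ S → AbsorbsCliquesThrough G Q w → IsClique G (Q ─ S)
  absorbing⇒isClique-minus {Q} {S} {w} ∣Q∣≡c+k ∣S∣≡k S⊆Q w∈Q w∉S absorbs
    with ft S (≤-reflexive ∣S∣≡k)
  ... | C , ∣C∣≡c , C-clique , C-avoids-S , C-disjoint
    with ⋃ᶠ-covers c S C ∣C∣≡c C-disjoint (λ i {v} → C-avoids-S i v) (cong (p * c +_) ∣S∣≡k) w∉S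
  ...   | i , w∈Cᵢ = λ u v u∈ v∈ → C-clique i u v (Q─S⊆Cᵢ u∈) (Q─S⊆Cᵢ v∈)
    where
    Cᵢ∪S⊆Q : C i ∪ S ⊆ Q
    Cᵢ∪S⊆Q x∈ with x∈p∪q⁻ (C i) S x∈
    ... | inj₁ x∈Cᵢ = absorbs (C i) (C-clique i) w∈Cᵢ x∈Cᵢ
    ... | inj₂ x∈S  = S⊆Q x∈S
    ∣Q∣≡∣Cᵢ∪S∣ : ∣ Q ∣ ≡ ∣ C i ∪ S ∣
    ∣Q∣≡∣Cᵢ∪S∣ = trans ∣Q∣≡c+k (sym (trans (∣p∪q∣≡∣p∣+∣q∣ (C i) S (C-avoids-S i _))
                                           (cong₂ _+_ (∣C∣≡c i) ∣S∣≡k)))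
    Q─S⊆Cᵢ : Q ─ S ⊆ C i
    Q─S⊆Cᵢ v∈Q─S with x∈p∪q⁻ (C i) S (p⊆q∧∣q∣≤∣p∣⇒q⊆p Cᵢ∪S⊆Q (≤-reflexive ∣Q∣≡∣Cᵢ∪S∣) (p─q⊆p Q S v∈Q─S))
    ... | inj₁ v∈Cᵢ = v∈Cᵢ
    ... | inj₂ v∈S  = ⊥-elim (x∈p─q⇒x∉q Q S v∈Q─S v∈S)

  absorbing⇒isClique : 3 ≤ c → {Q : Subset N} {w : Fin N} → ∣ Q ∣ ≡ c + k → w ∈ Q →
    AbsorbsCliquesThrough G Q w → IsClique G Q
  absorbing⇒isClique 3≤c {Q} {w} ∣Q∣≡c+k w∈Q absorbs a b a∈Q b∈Q =
    adjacent (⊆-ofSize-avoiding Q R k k+∣R∣≤∣Q∣)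
    where
    R : Subset N
    R = ⁅ a ⁆ ∪ ⁅ b ⁆ ∪ ⁅ w ⁆

    a∈R : a ∈ R
    a∈R = p⊆p∪q _ (x∈⁅x⁆ a)
    b∈R : b ∈ R
    b∈R = q⊆p∪q ⁅ a ⁆ _ (p⊆p∪q _ (x∈⁅x⁆ b))
    w∈R : w ∈ R
    w∈R = q⊆p∪q ⁅ a ⁆ _ (q⊆p∪q ⁅ b ⁆ _ (x∈⁅x⁆ w))

    ∣R∣≤3 : ∣ R ∣ ≤ 3
    ∣R∣≤3 = begin
      ∣ R ∣                                    ≤⟨ ∣p∪q∣≤∣p∣+∣q∣ ⁅ a ⁆ (⁅ b ⁆ ∪ ⁅ w ⁆) ⟩
      ∣ ⁅ a ⁆ ∣ + ∣ ⁅ b ⁆ ∪ ⁅ w ⁆ ∣              ≤⟨ +-monoʳ-≤ ∣ ⁅ a ⁆ ∣ (∣p∪q∣≤∣p∣+∣q∣ ⁅ b ⁆ ⁅ w ⁆) ⟩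
      ∣ ⁅ a ⁆ ∣ + (∣ ⁅ b ⁆ ∣ + ∣ ⁅ w ⁆ ∣)        ≡⟨ cong₂ _+_ (∣⁅x⁆∣≡1 a) (cong₂ _+_ (∣⁅x⁆∣≡1 b) (∣⁅x⁆∣≡1 w)) ⟩
      3                                        ∎
      where open ≤-Reasoning

    k+∣R∣≤∣Q∣ : k + ∣ R ∣ ≤ ∣ Q ∣
    k+∣R∣≤∣Q∣ = begin
      k + ∣ R ∣  ≤⟨ +-monoʳ-≤ k (≤-trans ∣R∣≤3 3≤c) ⟩
      k + c      ≡⟨ +-comm k c ⟩
      c + k      ≡⟨ sym ∣Q∣≡c+k ⟩
      ∣ Q ∣      ∎
      where open ≤-Reasoning

    adjacent : (∃ λ S → S ⊆ Q ─ R × ∣ S ∣ ≡ k) → a ≢ b → adj G a b ≡ true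
    adjacent (S , S⊆Q─R , ∣S∣≡k) =
      absorbing⇒isClique-minus ∣Q∣≡c+k ∣S∣≡k (p─q⊆p Q R ∘ S⊆Q─R) w∈Q (R∩S≡∅ w∈R) absorbs a b
        (x∈p∧x∉q⇒x∈p─q a∈Q (R∩S≡∅ a∈R)) (x∈p∧x∉q⇒x∈p─q b∈Q (R∩S≡∅ b∈R))
      where
      R∩S≡∅ : Disjoint R S
      R∩S≡∅ x∈R x∈S = x∈p─q⇒x∉q Q R (S⊆Q─R x∈S) x∈R

lemma2 : (k p c : ℕ) → 1 ≤ p → 3 ≤ c → (G : Graph (p * c + k)) → FT G k p c →
    ((x : Fin (p * c + k)) → suc (degree G x) ≡ c + k → Σ (Subset (p * c + k)) λ K →
      x ∈ K × ∣ K ∣ ≡ c + k × IsClique G K)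
    ×
    ((W A : Subset (p * c + k)) → IsSeparator G W → ∣ W ∣ ≡ k → IsComponent G W A →
      ∣ A ∣ ≡ c → IsClique G (W ∪ A))
lemma2 k p c _ 3≤c G ft =
  (λ x 1+deg≡c+k →
    let ∣closedNbhd∣≡c+k = trans (∣closedNbhd∣≡1+degree G x) 1+deg≡c+k in
    closedNbhd G x , x∈closedNbhd G x , ∣closedNbhd∣≡c+k ,
    absorbing⇒isClique G ft 3≤c ∣closedNbhd∣≡c+k (x∈closedNbhd G x) (closedNbhd-absorbs G x)) ,
  (λ { W A _ ∣W∣≡k A-component@((w , w∈A) , A-avoids-W , _) ∣A∣≡c →
    let ∣W∪A∣≡c+k = trans (∣p∪q∣≡∣p∣+∣q∣ W A (λ {v} v∈W v∈A → A-avoids-W v v∈A v∈W))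
                          (trans (cong₂ _+_ ∣W∣≡k ∣A∣≡c) (+-comm k c)) in
    absorbing⇒isClique G ft 3≤c ∣W∪A∣≡c+k (q⊆p∪q W A w∈A) (component-absorbs G A-component w∈A) })
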